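{- Let $Q$ be a finite Eulerian Sheffer poset of rank $2m+2$, $m\geq 2$, with binomial factorial function $B(k)=k!$ for $1\leq k\leq 2m+1$. Then it is impossible that the coatom function of $Q$ satisfies $C(n)=2(n-1)$ for $2\leq n\leq 2m$, $C(2m+1)=4m-2$ and $C(2m+2)=2m+1$.
   Context: A finite graded poset with minimum $\hat 0$ and maximum $\hat 1$ is Eulerian if every interval $[x,y]$ with $x<y$ has as many elements of even rank as of odd rank. A finite Sheffer poset is a finite poset with $\hat 0$ and $\hat 1$ in which every interval is graded, any two intervals $[\hat 0,y]$ of the same length $n$ have the same number $D(n)$ of maximal chains (Sheffer factorial function), and any two intervals $[x,y]$ of the same length $n$ with $x\neq\hat 0$ have the same number $B(n)$ of maximal chains (binomial factorial function). The coatom function is $C(n)=D(n)/D(n-1)$, the number of coatoms of an interval $[\hat 0,y]$ of length $n$. -}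

module Defs where

open import Data.Nat using (ℕ; zero; suc; _+_; _*_; _∸_; _<_; _≤_; _⊔_)

open import Data.Bool using (Bool; true; false; _∧_; not; if_then_else_)
open import Data.Fin using (Fin)
open import Data.Fin.Properties using (_≟_)
open import Data.List using (List; map; foldr; upTo; allFin)
open import Data.Nat.ListAction using (sum)
open import Data.Bool.ListAction using (any)
open import Relation.Nullary using (does)
open import Relation.Binary.PropositionalEquality using (_≡_)

record FinBoundedPoset : Set where
  field
    size    : ℕ
    le      : Fin size → Fin size → Bool
    refl    : ∀ x → le x x ≡ true
    antisym : ∀ x y → le x y ≡ true → le y x ≡ true → x ≡ y
    trans   : ∀ x y z → le x y ≡ true → le y z ≡ true → le x z ≡ true
    bot     : Fin size
    top     : Fin size
    bot-min : ∀ x → le bot x ≡ true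
    top-max : ∀ x → le x top ≡ true

module _ (P : FinBoundedPoset) where
  open FinBoundedPoset P

  elems : List (Fin size)
  elems = allFin size

  eqb : Fin size → Fin size → Bool
  eqb x y = does (x ≟ y)

  lt : Fin size → Fin size → Bool
  lt x y = le x y ∧ not (eqb x y)

  covers : Fin size → Fin size → Bool
  covers x y = lt x y ∧ not (any (λ w → lt x w ∧ lt w y) elems)

  -- chainCount k x y = number of saturated chains x = z₀ ⋖ z₁ ⋖ ⋯ ⋖ z_k = y,
  -- i.e. the number of maximal chains of length k of the interval [x,y].
  chainCount : ℕ → Fin size → Fin size → ℕ
  chainCount zero    x y = if eqb x y then 1 else 0
  chainCount (suc k) x y =
    sum (map (λ z → if covers x z then chainCount k z y else 0) elems)

  AllIntervalsGraded : Set
  AllIntervalsGraded = ∀ x y k l → 0 < chainCount k x y → 0 < chainCount l x y → k ≡ l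

  -- length of the interval [x,z] (the length of a longest maximal chain;
  -- in a graded interval this is its rank)
  len : Fin size → Fin size → ℕ
  len x z = foldr _⊔_ 0
    (map (λ k → if does (1 Data.Nat.≤? chainCount k x z) then k else 0) (upTo (suc size)))

  isEven : ℕ → Bool
  isEven zero = true
  isEven (suc n) = not (isEven n)

  inIv : Fin size → Fin size → Fin size → Bool
  inIv x y z = le x z ∧ le z y

  countIf : (Fin size → Bool) → ℕ
  countIf p = sum (map (λ z → if p z then 1 else 0) elems)

  -- Eulerian: every interval [x,y] with x < y has as many elements of even
  -- rank as of odd rank (rank of z in [x,y] = length of [x,z]).
  Eulerian : Set
  Eulerian = ∀ x y → lt x y ≡ true →
    countIf (λ z → inIv x y z ∧ isEven (len x z))
      ≡ countIf (λ z → inIv x y z ∧ not (isEven (len x z)))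

  IsSheffer : (D B : ℕ → ℕ) → Set
  IsSheffer D B =
    AllIntervalsGraded
    × (∀ y n → 0 < chainCount n bot y → chainCount n bot y ≡ D n)
    × (∀ x y n → (x ≡ bot → Data.Empty.⊥) → 0 < chainCount n x y → chainCount n x y ≡ B n)
    where open import Data.Product using (_×_)
          import Data.Empty

  HasRank : ℕ → Set
  HasRank r = 0 < chainCount r bot top

module Submission where

-- Write n = 2m, so Q has rank n + 2.  We show the stronger fact
-- that n divides C(n+1) whenever Q is a Sheffer poset of rank n + 2 (n ≥ 1)
-- with B(k) = k! for 1 ≤ k ≤ n + 1 and C(n+2) = n + 1; since 2m does not
-- divide 4m − 2 for m ≥ 2, the theorem follows.
--   * B(k) = k! forces every interval [x,y], x ≠ 0̂, of length k to have
--     exactly k atoms and k coatoms, and C(n+2) = n + 1 says that Q has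
--     n + 1 coatoms.  Take two of them, y₁ ≠ y₂.
--   * Above x ≠ 0̂ the intervals behave like Boolean lattices: by
--     inclusion–exclusion on atoms and induction, an x ≠ 0̂ lying below y₁
--     and y₂ at distance j + 1 has exactly j! saturated chains ending at a
--     common lower cover of y₁ and y₂.
--   * Counting the chains from 0̂ to common lower covers of y₁, y₂ in two
--     ways (through the atoms of Q, all of which lie below y₁ iff below y₂,
--     and through their last element) gives n·D(n)·Z = D(n+1) = C(n+1)·D(n),
--     where Z is the number of common lower covers of y₁ and y₂.

open import Defs
open import Data.Nat using (ℕ; _+_; _*_; _∸_; _≤_)
open import Data.Nat using (_!)
open import Data.Product using (_×_)
open import Relation.Nullary using (¬_)
open import Relation.Binary.PropositionalEquality using (_≡_)

open import Data.Nat using (zero; suc; _<_; z≤n; s≤s; ≢-nonZero)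
open import Data.Nat.Properties hiding (_≟_; suc-injective)
open import Data.Nat.Divisibility using (_∣_; divides; n∣m*n; ∣m+n∣m⇒∣n; ∣⇒≤)
import Data.Nat.ListAction as List
open import Data.Bool using (Bool; true; false; _∧_; _∨_; not; if_then_else_)
open import Data.Bool.Properties using (∧-comm)
open import Data.Fin using (Fin; zero; suc)
open import Data.Fin.Properties using (_≟_; suc-injective)
open import Data.List using (map; tabulate; allFin)
open import Data.List.Properties using (map-tabulate)
open import Data.Product using (Σ; ∃; _,_; proj₁; proj₂)
open import Data.Sum using (_⊎_; inj₁; inj₂)
open import Relation.Nullary using (does; yes; no)
open import Data.Empty using (⊥-elim)
open import Relation.Nullary.Decidable using (dec-true)
open import Relation.Binary.PropositionalEquality
  using (_≢_; refl; sym; trans; cong; cong₂; subst; subst₂; module ≡-Reasoning)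
open import Function using (id; _∘_)
open import Algebra.Properties.Semiring.Sum +-*-semiring
  using (sum; sum-syntax; sum-cong-≗; sum-replicate-zero; ∑-distrib-+; ∑-comm;
         *-distribˡ-sum; *-distribʳ-sum)

∧-true : ∀ {a b} → a ∧ b ≡ true → a ≡ true × b ≡ true
∧-true {true} b≡true = refl , b≡true

∨-true : ∀ {a b} → a ∨ b ≡ true → a ≡ true ⊎ b ≡ true
∨-true {true}  _      = inj₁ refl
∨-true {false} b≡true = inj₂ b≡true

∧-distribˡ-∧ : ∀ a b c → a ∧ (b ∧ c) ≡ (a ∧ b) ∧ (a ∧ c)
∧-distribˡ-∧ true  b c = refl
∧-distribˡ-∧ false b c = refl

≟-sound : ∀ {n} {x y : Fin n} → does (x ≟ y) ≡ true → x ≡ y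
≟-sound {x = x} {y} x≟y with x ≟ y
... | yes x≡y = x≡y

⟦_⟧ : Bool → ℕ
⟦ b ⟧ = if b then 1 else 0

positive : ℕ → Bool
positive zero    = false
positive (suc _) = true

positive⇒>0 : ∀ {c} → positive c ≡ true → 0 < c
positive⇒>0 {suc _} _ = s≤s z≤n

>0⇒positive : ∀ {c} → 0 < c → positive c ≡ true
>0⇒positive {suc _} _ = refl

⟦⟧>0 : ∀ {b} → 0 < ⟦ b ⟧ → b ≡ true
⟦⟧>0 {true} _ = refl

if⇒⟦⟧ : ∀ b c → (if b then c else 0) ≡ ⟦ b ⟧ * c
if⇒⟦⟧ true  c = sym (+-identityʳ c)
if⇒⟦⟧ false c = refl

⟦⟧-mono : ∀ {a b} → (a ≡ true → b ≡ true) → ⟦ a ⟧ ≤ ⟦ b ⟧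
⟦⟧-mono {false} _   = z≤n
⟦⟧-mono {true}  a⇒b rewrite a⇒b refl = ≤-refl

⟦⟧-∧∨ : ∀ a b → ⟦ a ∧ b ⟧ + ⟦ a ∨ b ⟧ ≡ ⟦ a ⟧ + ⟦ b ⟧
⟦⟧-∧∨ false b     = refl
⟦⟧-∧∨ true  false = refl
⟦⟧-∧∨ true  true  = refl

⟦⟧*-uniform : ∀ b c v → (b ≡ true → 0 < c → c ≡ v) → ⟦ b ⟧ * c ≡ v * ⟦ b ∧ positive c ⟧
⟦⟧*-uniform false c       v _ = sym (*-zeroʳ v)
⟦⟧*-uniform true  zero    v _ = sym (*-zeroʳ v)
⟦⟧*-uniform true  (suc c) v h =
  trans (+-identityʳ (suc c)) (trans (h refl (s≤s z≤n)) (sym (*-identityʳ v)))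

listSum-allFin : ∀ n (f : Fin n → ℕ) → List.sum (map f (allFin n)) ≡ ∑[ i < n ] f i
listSum-allFin n f = trans (cong List.sum (map-tabulate id f)) (listSum-tabulate n f)
  where
  listSum-tabulate : ∀ n (f : Fin n → ℕ) → List.sum (tabulate f) ≡ ∑[ i < n ] f i
  listSum-tabulate zero    f = refl
  listSum-tabulate (suc n) f = cong (f zero +_) (listSum-tabulate n (f ∘ suc))

∑-mono : ∀ n {f g : Fin n → ℕ} → (∀ i → f i ≤ g i) → sum f ≤ sum g
∑-mono zero    f≤g = z≤n
∑-mono (suc n) f≤g = +-mono-≤ (f≤g zero) (∑-mono n (f≤g ∘ suc))

∑-strict : ∀ n {f g : Fin n → ℕ} → (∀ i → f i ≤ g i) → ∀ i → f i < g i → sum f < sum g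
∑-strict (suc n) f≤g zero    fi<gi = +-mono-<-≤ fi<gi (∑-mono n (f≤g ∘ suc))
∑-strict (suc n) f≤g (suc i) fi<gi = +-mono-≤-< (f≤g zero) (∑-strict n (f≤g ∘ suc) i fi<gi)

∑-term : ∀ n (f : Fin n → ℕ) i → f i ≤ sum f
∑-term (suc n) f zero    = m≤m+n (f zero) _
∑-term (suc n) f (suc i) = ≤-trans (∑-term n (f ∘ suc) i) (m≤n+m _ (f zero))

∑-pickˡ : ∀ n (f : Fin n → ℕ) x → ∑[ z < n ] (⟦ does (x ≟ z) ⟧ * f z) ≡ f x
∑-pickˡ (suc n) f zero =
  trans (cong₂ _+_ (+-identityʳ (f zero)) (sum-replicate-zero n)) (+-identityʳ (f zero))
∑-pickˡ (suc n) f (suc x) = ∑-pickˡ n (f ∘ suc) x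

∑-pickʳ : ∀ n (f : Fin n → ℕ) y → ∑[ z < n ] (f z * ⟦ does (z ≟ y) ⟧) ≡ f y
∑-pickʳ (suc n) f zero = trans
  (cong₂ _+_ (*-identityʳ (f zero))
             (trans (sum-cong-≗ (λ i → *-zeroʳ (f (suc i)))) (sum-replicate-zero n)))
  (+-identityʳ (f zero))
∑-pickʳ (suc n) f (suc y) = trans (cong (_+ ∑[ z < n ] (f (suc z) * ⟦ does (z ≟ y) ⟧)) (*-zeroʳ (f zero)))
    (∑-pickʳ n (f ∘ suc) y)

count : ∀ {n} → (Fin n → Bool) → ℕ
count {n} p = ∑[ z < n ] ⟦ p z ⟧

_⊆_ : ∀ {n} → (Fin n → Bool) → (Fin n → Bool) → Set
p ⊆ q = ∀ z → p z ≡ true → q z ≡ true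

count-cong : ∀ {n} {p q : Fin n → Bool} → (∀ z → p z ≡ q z) → count p ≡ count q
count-cong p≡q = sum-cong-≗ (cong ⟦_⟧ ∘ p≡q)

∑-indicator : ∀ n (f : Fin n → ℕ) v (p : Fin n → Bool) →
  (∀ z → f z ≡ v * ⟦ p z ⟧) → sum f ≡ v * count p
∑-indicator n f v p f≡ = trans (sum-cong-≗ f≡) (sym (*-distribˡ-sum v (⟦_⟧ ∘ p)))

∑-uniformˡ : ∀ n (b : Fin n → Bool) (f : Fin n → ℕ) v → (∀ z → b z ≡ true → 0 < f z → f z ≡ v) →
  ∑[ z < n ] (⟦ b z ⟧ * f z) ≡ v * count (λ z → b z ∧ positive (f z))
∑-uniformˡ n b f v uniform =
  ∑-indicator n _ v _ (λ z → ⟦⟧*-uniform (b z) (f z) v (uniform z))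

∑-uniformʳ : ∀ n (b : Fin n → Bool) (f : Fin n → ℕ) v → (∀ z → b z ≡ true → 0 < f z → f z ≡ v) →
  ∑[ z < n ] (f z * ⟦ b z ⟧) ≡ v * count (λ z → positive (f z) ∧ b z)
∑-uniformʳ n b f v uniform = ∑-indicator n _ v _ term
  where
  term : ∀ z → f z * ⟦ b z ⟧ ≡ v * ⟦ positive (f z) ∧ b z ⟧
  term z = begin
    f z * ⟦ b z ⟧                ≡⟨ *-comm (f z) ⟦ b z ⟧ ⟩
    ⟦ b z ⟧ * f z                ≡⟨ ⟦⟧*-uniform (b z) (f z) v (uniform z) ⟩
    v * ⟦ b z ∧ positive (f z) ⟧ ≡⟨ cong (λ b → v * ⟦ b ⟧) (∧-comm (b z) (positive (f z))) ⟩
    v * ⟦ positive (f z) ∧ b z ⟧ ∎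
    where open ≡-Reasoning

count-mono : ∀ {n} {p q : Fin n → Bool} → p ⊆ q → count p ≤ count q
count-mono {n} p⊆q = ∑-mono n (λ z → ⟦⟧-mono (p⊆q z))

count-strict : ∀ {n} {p q : Fin n → Bool} → p ⊆ q →
  ∀ z → p z ≡ false → q z ≡ true → count p < count q
count-strict {n} {p} {q} p⊆q z pz qz = ∑-strict n (λ z → ⟦⟧-mono (p⊆q z)) z ⟦pz⟧<⟦qz⟧
  where
  ⟦pz⟧<⟦qz⟧ : ⟦ p z ⟧ < ⟦ q z ⟧
  ⟦pz⟧<⟦qz⟧ rewrite pz | qz = s≤s z≤n

count-strict₂ : ∀ {n} {p q : Fin n → Bool} → p ⊆ q → ∀ z₁ z₂ → z₁ ≢ z₂ →
  p z₁ ≡ false → q z₁ ≡ true → p z₂ ≡ false → q z₂ ≡ true → 2 + count p ≤ count q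
count-strict₂ {n} {p} {q} p⊆q z₁ z₂ z₁≢z₂ pz₁ qz₁ pz₂ qz₂ =
  ≤-trans (s≤s (count-strict p⊆p′ z₁ pz₁ p′z₁)) (count-strict p′⊆q z₂ p′z₂ qz₂)
  where
  p′ : Fin n → Bool
  p′ z = p z ∨ does (z₁ ≟ z)
  p⊆p′ : p ⊆ p′
  p⊆p′ z pz rewrite pz = refl
  p′z₁ : p′ z₁ ≡ true
  p′z₁ rewrite pz₁ = dec-true (z₁ ≟ z₁) refl
  p′⊆q : p′ ⊆ q
  p′⊆q z p′z with ∨-true {p z} p′z
  ... | inj₁ pz  = p⊆q z pz
  ... | inj₂ z₁≟z = subst (λ z → q z ≡ true) (≟-sound z₁≟z) qz₁
  p′z₂ : p′ z₂ ≡ false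
  p′z₂ rewrite pz₂ with z₁ ≟ z₂
  ... | yes z₁≡z₂ = ⊥-elim (z₁≢z₂ z₁≡z₂)
  ... | no _      = refl

count-∧∨ : ∀ {n} (p q : Fin n → Bool) →
  count (λ z → p z ∧ q z) + count (λ z → p z ∨ q z) ≡ count p + count q
count-∧∨ {n} p q = begin
  count (λ z → p z ∧ q z) + count (λ z → p z ∨ q z)
    ≡⟨ ∑-distrib-+ (λ z → ⟦ p z ∧ q z ⟧) (λ z → ⟦ p z ∨ q z ⟧) ⟨
  ∑[ z < n ] (⟦ p z ∧ q z ⟧ + ⟦ p z ∨ q z ⟧)
    ≡⟨ sum-cong-≗ (λ z → ⟦⟧-∧∨ (p z) (q z)) ⟩
  ∑[ z < n ] (⟦ p z ⟧ + ⟦ q z ⟧)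
    ≡⟨ ∑-distrib-+ (⟦_⟧ ∘ p) (⟦_⟧ ∘ q) ⟩
  count p + count q ∎
  where open ≡-Reasoning

count-witness : ∀ {n} (p : Fin n → Bool) → 0 < count p → ∃ λ z → p z ≡ true
count-witness {suc n} p pos with p zero in pz
... | true  = zero , pz
... | false with count-witness (p ∘ suc) pos
...   | z , psz = suc z , psz

count-witnesses : ∀ {n} (p : Fin n → Bool) → 2 ≤ count p →
  Σ (Fin n) λ z₁ → Σ (Fin n) λ z₂ → z₁ ≢ z₂ × p z₁ ≡ true × p z₂ ≡ true
count-witnesses {suc n} p two with p zero in pz
... | true with count-witness (p ∘ suc) (≤-pred two)
...   | z , psz = zero , suc z , (λ ()) , pz , psz
count-witnesses {suc n} p two | false with count-witnesses (p ∘ suc) two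
...   | z₁ , z₂ , z₁≢z₂ , pz₁ , pz₂ = suc z₁ , suc z₂ , z₁≢z₂ ∘ suc-injective , pz₁ , pz₂

module Chains (Q : FinBoundedPoset) where
  open FinBoundedPoset Q using (size; antisym; bot; bot-min)

  infix 7 _⋖_
  _⋖_ : Fin size → Fin size → Bool
  x ⋖ y = covers Q x y

  chains : ℕ → Fin size → Fin size → ℕ
  chains = chainCount Q

  reaches : ℕ → Fin size → Fin size → Bool
  reaches k x y = positive (chains k x y)

  -- Upper covers of x from which y is reached in k steps: for [x,y] of
  -- length k + 1 these are the atoms of [x,y].
  atoms : ℕ → Fin size → Fin size → Fin size → Bool
  atoms k x y z = x ⋖ z ∧ reaches k z y

  -- Lower covers of w reached from x in k steps: for [x,w] of length
  -- k + 1 these are the coatoms of [x,w].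
  coatoms : ℕ → Fin size → Fin size → Fin size → Bool
  coatoms k x w z = reaches k x z ∧ z ⋖ w

  chains-first : ∀ k x y → chains (suc k) x y ≡ ∑[ z < size ] (⟦ x ⋖ z ⟧ * chains k z y)
  chains-first k x y = trans (listSum-allFin size _)
    (sum-cong-≗ (λ z → if⇒⟦⟧ (x ⋖ z) (chains k z y)))

  chains-one : ∀ x y → chains 1 x y ≡ ⟦ x ⋖ y ⟧
  chains-one x y = trans (chains-first 0 x y) (∑-pickʳ size (λ z → ⟦ x ⋖ z ⟧) y)

  chains-last : ∀ k x y → chains (suc k) x y ≡ ∑[ z < size ] (chains k x z * ⟦ z ⋖ y ⟧)
  chains-last zero x y =
    trans (chains-one x y) (sym (∑-pickˡ size (λ z → ⟦ z ⋖ y ⟧) x))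
  chains-last (suc k) x y = begin
    chains (suc (suc k)) x y
      ≡⟨ chains-first (suc k) x y ⟩
    ∑[ w < size ] (⟦ x ⋖ w ⟧ * chains (suc k) w y)
      ≡⟨ sum-cong-≗ (λ w → cong (⟦ x ⋖ w ⟧ *_) (chains-last k w y)) ⟩
    ∑[ w < size ] (⟦ x ⋖ w ⟧ * ∑[ z < size ] (chains k w z * ⟦ z ⋖ y ⟧))
      ≡⟨ sum-cong-≗ (λ w → *-distribˡ-sum ⟦ x ⋖ w ⟧ (λ z → chains k w z * ⟦ z ⋖ y ⟧)) ⟩
    ∑[ w < size ] ∑[ z < size ] (⟦ x ⋖ w ⟧ * (chains k w z * ⟦ z ⋖ y ⟧))
      ≡⟨ ∑-comm (λ w z → ⟦ x ⋖ w ⟧ * (chains k w z * ⟦ z ⋖ y ⟧)) ⟩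
    ∑[ z < size ] ∑[ w < size ] (⟦ x ⋖ w ⟧ * (chains k w z * ⟦ z ⋖ y ⟧))
      ≡⟨ sum-cong-≗ (λ z → sum-cong-≗ (λ w → *-assoc ⟦ x ⋖ w ⟧ _ ⟦ z ⋖ y ⟧)) ⟨
    ∑[ z < size ] ∑[ w < size ] (⟦ x ⋖ w ⟧ * chains k w z * ⟦ z ⋖ y ⟧)
      ≡⟨ sum-cong-≗ (λ z → *-distribʳ-sum ⟦ z ⋖ y ⟧ (λ w → ⟦ x ⋖ w ⟧ * chains k w z)) ⟨
    ∑[ z < size ] (∑[ w < size ] (⟦ x ⋖ w ⟧ * chains k w z) * ⟦ z ⋖ y ⟧)
      ≡⟨ sum-cong-≗ (λ z → cong (_* ⟦ z ⋖ y ⟧) (chains-first k x z)) ⟨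
    ∑[ z < size ] (chains (suc k) x z * ⟦ z ⋖ y ⟧) ∎
    where open ≡-Reasoning

  chains-extendˡ : ∀ k x z y → x ⋖ z ≡ true → 0 < chains k z y → 0 < chains (suc k) x y
  chains-extendˡ k x z y x⋖z 0<chains = ≤-trans
    (subst (λ b → 0 < ⟦ b ⟧ * chains k z y) (sym x⋖z) (subst (0 <_) (sym (+-identityʳ _)) 0<chains))
    (subst (⟦ x ⋖ z ⟧ * chains k z y ≤_) (sym (chains-first k x y))
      (∑-term size (λ z → ⟦ x ⋖ z ⟧ * chains k z y) z))

  chains-extendʳ : ∀ k x z y → 0 < chains k x z → z ⋖ y ≡ true → 0 < chains (suc k) x y
  chains-extendʳ k x z y 0<chains z⋖y = ≤-trans
    (subst (λ b → 0 < chains k x z * ⟦ b ⟧) (sym z⋖y) (subst (0 <_) (sym (*-identityʳ _)) 0<chains))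
    (subst (chains k x z * ⟦ z ⋖ y ⟧ ≤_) (sym (chains-last k x y))
      (∑-term size (λ z → chains k x z * ⟦ z ⋖ y ⟧) z))

  covers-nonbot : ∀ x z → x ⋖ z ≡ true → z ≢ bot
  covers-nonbot x z x⋖z refl with ∧-true (proj₁ (∧-true x⋖z))
  ... | x≤⊥ , x≢⊥
    with subst (λ b → not b ≡ true) (dec-true (x ≟ bot) (antisym x bot x≤⊥ (bot-min x))) x≢⊥
  ... | ()

  coatoms-mono : ∀ k x x′ w → x ⋖ x′ ≡ true → coatoms k x′ w ⊆ coatoms (suc k) x w
  coatoms-mono k x x′ w x⋖x′ y y∈ with ∧-true {reaches k x′ y} y∈
  ... | x′→y , y⋖w rewrite >0⇒positive (chains-extendˡ k x x′ y x⋖x′ (positive⇒>0 x′→y)) = y⋖w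

  atoms-mono : ∀ k x y w → y ⋖ w ≡ true → atoms k x y ⊆ atoms (suc k) x w
  atoms-mono k x y w y⋖w z z∈ with ∧-true {x ⋖ z} z∈
  ... | x⋖z , z→y rewrite x⋖z = >0⇒positive (chains-extendʳ k z y w (positive⇒>0 z→y) y⋖w)

  chains-via-atoms : ∀ L x y v → (∀ z → x ⋖ z ≡ true → 0 < chains L z y → chains L z y ≡ v) →
    chains (suc L) x y ≡ v * count (atoms L x y)
  chains-via-atoms L x y v uniform =
    trans (chains-first L x y) (∑-uniformˡ size (x ⋖_) (λ z → chains L z y) v uniform)

  chains-via-coatoms : ∀ L x w v → (∀ z → z ⋖ w ≡ true → 0 < chains L x z → chains L x z ≡ v) →
    chains (suc L) x w ≡ v * count (coatoms L x w)
  chains-via-coatoms L x w v uniform =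
    trans (chains-last L x w) (∑-uniformʳ size (_⋖ w) (chains L x) v uniform)

module FactorialSheffer (Q : FinBoundedPoset) (D B : ℕ → ℕ) (sheffer : IsSheffer Q D B)
  (r : ℕ) (B≡! : ∀ k → 1 ≤ k → k ≤ r → B k ≡ k !) where
  open FinBoundedPoset Q using (size; bot; top)
  open Chains Q

  sheffer-chains : ∀ y k → 0 < chains k bot y → chains k bot y ≡ D k
  sheffer-chains = proj₁ (proj₂ sheffer)

  binomial-chains : ∀ x y k → x ≢ bot → 1 ≤ k → k ≤ r → 0 < chains k x y → chains k x y ≡ k !
  binomial-chains x y k x≢⊥ 1≤k k≤r 0<chains =
    trans (proj₂ (proj₂ sheffer) x y k x≢⊥ 0<chains) (B≡! k 1≤k k≤r)

  !-cancel : ∀ L c → L ! * c ≡ suc L ! → c ≡ suc L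
  !-cancel L c L!c≡ = *-cancelʳ-≡ c (suc L) (L !) {{L !≢0}} (trans (*-comm c (L !)) L!c≡)

  -- An interval [x,y] with x ≠ 0̂ of length L + 1 ≤ r has exactly L + 1
  -- atoms, since (L+1)! = (L+1) · L!.
  atom-count : ∀ L x y → x ≢ bot → 1 ≤ L → suc L ≤ r → 0 < chains (suc L) x y →
    count (atoms L x y) ≡ suc L
  atom-count L x y x≢⊥ 1≤L L<r 0<chains = !-cancel L _ (trans
    (sym (chains-via-atoms L x y (L !)
      (λ z x⋖z → binomial-chains z y L (covers-nonbot x z x⋖z) 1≤L (≤-trans (n≤1+n L) L<r))))
    (binomial-chains x y (suc L) x≢⊥ (s≤s z≤n) L<r 0<chains))

  coatom-count : ∀ L x w → x ≢ bot → 1 ≤ L → suc L ≤ r → 0 < chains (suc L) x w →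
    count (coatoms L x w) ≡ suc L
  coatom-count L x w x≢⊥ 1≤L L<r 0<chains = !-cancel L _ (trans
    (sym (chains-via-coatoms L x w (L !)
      (λ z _ → binomial-chains x z L x≢⊥ 1≤L (≤-trans (n≤1+n L) L<r))))
    (binomial-chains x w (suc L) x≢⊥ (s≤s z≤n) L<r 0<chains))

  module TwoCoatoms (y₁ y₂ : Fin size) (y₁≢y₂ : y₁ ≢ y₂)
    (y₁⋖⊤ : y₁ ⋖ top ≡ true) (y₂⋖⊤ : y₂ ⋖ top ≡ true) where

    belowBoth : Fin size → Bool
    belowBoth z = z ⋖ y₁ ∧ z ⋖ y₂

    commonAtoms : ℕ → Fin size → Fin size → Bool
    commonAtoms j x z = x ⋖ z ∧ (reaches j z y₁ ∧ reaches j z y₂)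

    chainsToCommon : ℕ → Fin size → ℕ
    chainsToCommon j x = ∑[ z < size ] (chains j x z * ⟦ belowBoth z ⟧)

    chainsToCommon-first : ∀ j x →
      chainsToCommon (suc j) x ≡ ∑[ z < size ] (⟦ x ⋖ z ⟧ * chainsToCommon j z)
    chainsToCommon-first j x = begin
      ∑[ w < size ] (chains (suc j) x w * ⟦ belowBoth w ⟧)
        ≡⟨ sum-cong-≗ (λ w → cong (_* ⟦ belowBoth w ⟧) (chains-first j x w)) ⟩
      ∑[ w < size ] (∑[ z < size ] (⟦ x ⋖ z ⟧ * chains j z w) * ⟦ belowBoth w ⟧)
        ≡⟨ sum-cong-≗ (λ w → *-distribʳ-sum ⟦ belowBoth w ⟧ (λ z → ⟦ x ⋖ z ⟧ * chains j z w)) ⟩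
      ∑[ w < size ] ∑[ z < size ] (⟦ x ⋖ z ⟧ * chains j z w * ⟦ belowBoth w ⟧)
        ≡⟨ ∑-comm (λ w z → ⟦ x ⋖ z ⟧ * chains j z w * ⟦ belowBoth w ⟧) ⟩
      ∑[ z < size ] ∑[ w < size ] (⟦ x ⋖ z ⟧ * chains j z w * ⟦ belowBoth w ⟧)
        ≡⟨ sum-cong-≗ (λ z → sum-cong-≗ (λ w → *-assoc ⟦ x ⋖ z ⟧ (chains j z w) _)) ⟩
      ∑[ z < size ] ∑[ w < size ] (⟦ x ⋖ z ⟧ * (chains j z w * ⟦ belowBoth w ⟧))
        ≡⟨ sum-cong-≗ (λ z → *-distribˡ-sum ⟦ x ⋖ z ⟧ (λ w → chains j z w * ⟦ belowBoth w ⟧)) ⟨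
      ∑[ z < size ] (⟦ x ⋖ z ⟧ * chainsToCommon j z) ∎
      where open ≡-Reasoning

    chainsToCommon≤ : ∀ j x y → (∀ z → belowBoth z ≡ true → z ⋖ y ≡ true) →
      chainsToCommon j x ≤ chains (suc j) x y
    chainsToCommon≤ j x y below = subst (chainsToCommon j x ≤_) (sym (chains-last j x y))
      (∑-mono size (λ z → *-monoʳ-≤ (chains j x z) (⟦⟧-mono (below z))))

    -- Every atom of [x,1̂] lies below y₁ or y₂: otherwise the coatoms of
    -- [x′,1̂] would be among the coatoms of [x,1̂] other than y₁, y₂, but
    -- both intervals are binomial, with j + 2 and j + 3 coatoms.
    atom-below-y₁-or-y₂ : ∀ j x → x ≢ bot → 3 + j ≤ r →
      0 < chains (suc (suc j)) x y₁ → 0 < chains (suc (suc j)) x y₂ →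
      ∀ x′ → atoms (suc (suc j)) x top x′ ≡ true →
      atoms (suc j) x y₁ x′ ∨ atoms (suc j) x y₂ x′ ≡ true
    atom-below-y₁-or-y₂ j x x≢⊥ j+3≤r x→y₁ x→y₂ x′ x′∈ with ∧-true {x ⋖ x′} x′∈
    ... | x⋖x′ , x′→⊤ rewrite x⋖x′ with reaches (suc j) x′ y₁ in r₁ | reaches (suc j) x′ y₂ in r₂
    ...   | true  | _     = refl
    ...   | false | true  = refl
    ...   | false | false = ⊥-elim (<-irrefl refl (≤-trans too-many (≤-reflexive #coatoms-x)))
      where
      #coatoms-x′ : count (coatoms (suc j) x′ top) ≡ 2 + j
      #coatoms-x′ = coatom-count (suc j) x′ top (covers-nonbot x x′ x⋖x′) (s≤s z≤n)
        (≤-trans (n≤1+n _) j+3≤r) (positive⇒>0 x′→⊤)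
      #coatoms-x : count (coatoms (suc (suc j)) x top) ≡ 3 + j
      #coatoms-x = coatom-count (suc (suc j)) x top x≢⊥ (s≤s z≤n) j+3≤r
        (chains-extendʳ (suc (suc j)) x y₁ top x→y₁ y₁⋖⊤)
      yᵢ∈ : ∀ {yᵢ} → 0 < chains (suc (suc j)) x yᵢ → yᵢ ⋖ top ≡ true →
        coatoms (suc (suc j)) x top yᵢ ≡ true
      yᵢ∈ x→yᵢ yᵢ⋖⊤ rewrite >0⇒positive x→yᵢ = yᵢ⋖⊤
      yᵢ∉ : ∀ {yᵢ} → reaches (suc j) x′ yᵢ ≡ false → coatoms (suc j) x′ top yᵢ ≡ false
      yᵢ∉ x′↛yᵢ rewrite x′↛yᵢ = refl
      too-many : 4 + j ≤ count (coatoms (suc (suc j)) x top)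
      too-many = subst (λ c → 2 + c ≤ _) #coatoms-x′
        (count-strict₂ (coatoms-mono (suc j) x x′ top x⋖x′) y₁ y₂ y₁≢y₂
          (yᵢ∉ r₁) (yᵢ∈ x→y₁ y₁⋖⊤) (yᵢ∉ r₂) (yᵢ∈ x→y₂ y₂⋖⊤))

    -- Inclusion–exclusion: the j + 3 atoms of [x,1̂] are the union of the
    -- j + 2 atoms of [x,y₁] and the j + 2 atoms of [x,y₂], so j + 1 of them
    -- lie below both.
    commonAtom-count : ∀ j x → x ≢ bot → 3 + j ≤ r →
      0 < chains (suc (suc j)) x y₁ → 0 < chains (suc (suc j)) x y₂ →
      count (commonAtoms (suc j) x) ≡ suc j
    commonAtom-count j x x≢⊥ j+3≤r x→y₁ x→y₂ = +-cancelʳ-≡ (3 + j) _ (suc j) (begin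
      count (commonAtoms (suc j) x) + (3 + j)
        ≡⟨ cong₂ _+_ (count-cong (λ z → ∧-distribˡ-∧ (x ⋖ z) _ _)) (sym #union) ⟩
      count (λ z → A₁ z ∧ A₂ z) + count (λ z → A₁ z ∨ A₂ z)
        ≡⟨ count-∧∨ A₁ A₂ ⟩
      count A₁ + count A₂
        ≡⟨ cong₂ _+_ (#atoms y₁ x→y₁) (#atoms y₂ x→y₂) ⟩
      (2 + j) + (2 + j)
        ≡⟨ cong suc (+-suc j (2 + j)) ⟨
      suc j + (3 + j) ∎)
      where
      open ≡-Reasoning
      A₁ A₂ : Fin size → Bool
      A₁ = atoms (suc j) x y₁
      A₂ = atoms (suc j) x y₂
      #atoms : ∀ yᵢ → 0 < chains (suc (suc j)) x yᵢ → count (atoms (suc j) x yᵢ) ≡ 2 + j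
      #atoms yᵢ x→yᵢ = atom-count (suc j) x yᵢ x≢⊥ (s≤s z≤n) (≤-trans (n≤1+n _) j+3≤r) x→yᵢ
      union⊆ : (λ z → A₁ z ∨ A₂ z) ⊆ atoms (suc (suc j)) x top
      union⊆ z z∈ with ∨-true {A₁ z} z∈
      ... | inj₁ z∈A₁ = atoms-mono (suc j) x y₁ top y₁⋖⊤ z z∈A₁
      ... | inj₂ z∈A₂ = atoms-mono (suc j) x y₂ top y₂⋖⊤ z z∈A₂
      #union : count (λ z → A₁ z ∨ A₂ z) ≡ 3 + j
      #union = trans
        (≤-antisym (count-mono union⊆) (count-mono (atom-below-y₁-or-y₂ j x x≢⊥ j+3≤r x→y₁ x→y₂)))
        (atom-count (suc (suc j)) x top x≢⊥ (s≤s z≤n) j+3≤r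
          (chains-extendʳ (suc (suc j)) x y₁ top x→y₁ y₁⋖⊤))

    chainsToCommon-via-atoms : ∀ j →
      (∀ x′ → x′ ≢ bot → 0 < chains (suc j) x′ y₁ → 0 < chains (suc j) x′ y₂ →
         chainsToCommon j x′ ≡ j !) →
      ∀ x → chainsToCommon (suc j) x ≡ j ! * count (commonAtoms (suc j) x)
    chainsToCommon-via-atoms j hyp x =
      trans (chainsToCommon-first j x) (∑-indicator size _ (j !) (commonAtoms (suc j) x) term)
      where
      vanish : ∀ x′ y → (∀ z → belowBoth z ≡ true → z ⋖ y ≡ true) →
        chains (suc j) x′ y ≡ 0 → chainsToCommon j x′ ≡ 0
      vanish x′ y below no-chain = n≤0⇒n≡0 (subst (_ ≤_) no-chain (chainsToCommon≤ j x′ y below))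
      term : ∀ x′ → ⟦ x ⋖ x′ ⟧ * chainsToCommon j x′ ≡ j ! * ⟦ commonAtoms (suc j) x x′ ⟧
      term x′ with x ⋖ x′ in x⋖x′
      ... | false = sym (*-zeroʳ (j !))
      ... | true with chains (suc j) x′ y₁ in c₁ | chains (suc j) x′ y₂ in c₂
      ...   | zero  | _     = trans (+-identityʳ _)
              (trans (vanish x′ y₁ (λ z → proj₁ ∘ ∧-true) c₁) (sym (*-zeroʳ (j !))))
      ...   | suc _ | zero  = trans (+-identityʳ _)
              (trans (vanish x′ y₂ (λ z → proj₂ ∘ ∧-true {z ⋖ y₁}) c₂) (sym (*-zeroʳ (j !))))
      ...   | suc _ | suc _ = trans (+-identityʳ _)
              (trans (hyp x′ (covers-nonbot x x′ x⋖x′) (subst (0 <_) (sym c₁) (s≤s z≤n))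
                                                        (subst (0 <_) (sym c₂) (s≤s z≤n)))
                     (sym (*-identityʳ (j !))))

    chainsToCommon-factorial : ∀ j → 2 + j ≤ r →
      ∀ x → x ≢ bot → 0 < chains (suc j) x y₁ → 0 < chains (suc j) x y₂ →
      chainsToCommon j x ≡ j !
    chainsToCommon-factorial zero _ x _ x→y₁ x→y₂ = trans (∑-pickˡ size (⟦_⟧ ∘ belowBoth) x) both
      where
      both : ⟦ belowBoth x ⟧ ≡ 1
      both rewrite ⟦⟧>0 (subst (0 <_) (chains-one x y₁) x→y₁)
                 | ⟦⟧>0 (subst (0 <_) (chains-one x y₂) x→y₂) = refl
    chainsToCommon-factorial (suc j) j+3≤r x x≢⊥ x→y₁ x→y₂ = begin
      chainsToCommon (suc j) x
        ≡⟨ chainsToCommon-via-atoms j (chainsToCommon-factorial j (≤-trans (n≤1+n _) j+3≤r)) x ⟩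
      j ! * count (commonAtoms (suc j) x)
        ≡⟨ cong (j ! *_) (commonAtom-count j x x≢⊥ j+3≤r x→y₁ x→y₂) ⟩
      j ! * suc j
        ≡⟨ *-comm (j !) (suc j) ⟩
      suc j ! ∎
      where open ≡-Reasoning

-- The divisibility n ∣ C(n+1), for a Sheffer poset of rank n + 2 with
-- B(i) = i! (1 ≤ i ≤ n + 1) and C(n+2) = n + 1.  Here n = k + 1.

module CoatomDivisibility (Q : FinBoundedPoset) (D B : ℕ → ℕ) (sheffer : IsSheffer Q D B)
  (k c : ℕ)
  (rank : 0 < chainCount Q (3 + k) (FinBoundedPoset.bot Q) (FinBoundedPoset.top Q))
  (B≡! : ∀ i → 1 ≤ i → i ≤ 2 + k → B i ≡ i !)
  (C[n+1] : D (2 + k) ≡ c * D (1 + k))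
  (C[n+2] : D (3 + k) ≡ (2 + k) * D (2 + k)) where
  open FinBoundedPoset Q using (size; bot; top)
  open Chains Q
  open FactorialSheffer Q D B sheffer (2 + k) B≡!

  n : ℕ
  n = suc k

  -- D(n+2) = (n+1)·D(n+1) counts the (nonzero number of) maximal chains
  -- of Q, so D(n+1) and D(n) are nonzero.
  D[n+2]-chains : chains (2 + n) bot top ≡ (1 + n) * D (1 + n)
  D[n+2]-chains = trans (sheffer-chains top (2 + n) rank) C[n+2]

  D[n+1]≢0 : D (1 + n) ≢ 0
  D[n+1]≢0 D≡0 =
    <-irrefl (sym (trans D[n+2]-chains (trans (cong (suc n *_) D≡0) (*-zeroʳ (suc n))))) rank

  D[n]≢0 : D n ≢ 0
  D[n]≢0 D≡0 = D[n+1]≢0 (trans C[n+1] (trans (cong (c *_) D≡0) (*-zeroʳ c)))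

  -- C(n+2) = n + 1 means that Q has n + 1 coatoms.
  #coatoms : count (coatoms (1 + n) bot top) ≡ 1 + n
  #coatoms = *-cancelʳ-≡ _ (1 + n) (D (1 + n)) {{≢-nonZero D[n+1]≢0}} (trans
    (*-comm (count (coatoms (1 + n) bot top)) (D (1 + n)))
    (trans (sym (chains-via-coatoms (1 + n) bot top (D (1 + n)) (λ z _ → sheffer-chains z (1 + n))))
           D[n+2]-chains))

  module BelowTwoCoatoms (y₁ y₂ : Fin size) (y₁≢y₂ : y₁ ≢ y₂)
    (y₁∈ : coatoms (1 + n) bot top y₁ ≡ true) (y₂∈ : coatoms (1 + n) bot top y₂ ≡ true) where
    ⊥→y₁ : 0 < chains (1 + n) bot y₁
    ⊥→y₁ = positive⇒>0 (proj₁ (∧-true y₁∈))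
    y₁⋖⊤ : y₁ ⋖ top ≡ true
    y₁⋖⊤ = proj₂ (∧-true {reaches (1 + n) bot y₁} y₁∈)
    y₂⋖⊤ : y₂ ⋖ top ≡ true
    y₂⋖⊤ = proj₂ (∧-true {reaches (1 + n) bot y₂} y₂∈)

    open TwoCoatoms y₁ y₂ y₁≢y₂ y₁⋖⊤ y₂⋖⊤

    -- Every atom a of Q below y₁ is below y₂: [a,1̂] has n + 1 coatoms, all
    -- of them coatoms of Q, so these are all n + 1 coatoms of Q.
    atom-below-y₂ : ∀ a → bot ⋖ a ≡ true → reaches n a y₁ ≡ true → reaches n a y₂ ≡ true
    atom-below-y₂ a ⊥⋖a a→y₁ with reaches n a y₂ in a→y₂
    ... | true  = refl
    ... | false = ⊥-elim (<-irrefl refl (≤-trans too-many (≤-reflexive #coatoms)))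
      where
      #coatoms-a : count (coatoms n a top) ≡ 1 + n
      #coatoms-a = coatom-count n a top (covers-nonbot bot a ⊥⋖a) (s≤s z≤n) ≤-refl
        (chains-extendʳ n a y₁ top (positive⇒>0 a→y₁) y₁⋖⊤)
      y₂∉ : coatoms n a top y₂ ≡ false
      y₂∉ rewrite a→y₂ = refl
      too-many : 2 + n ≤ count (coatoms (1 + n) bot top)
      too-many = subst (λ m → suc m ≤ _) #coatoms-a
        (count-strict (coatoms-mono n bot a top ⊥⋖a) y₂ y₂∉ y₂∈)

    commonAtoms≡atoms : ∀ a → commonAtoms n bot a ≡ atoms n bot y₁ a
    commonAtoms≡atoms a with bot ⋖ a in ⊥⋖a | reaches n a y₁ in a→y₁
    ... | false | _     = refl
    ... | true  | false = refl
    ... | true  | true  rewrite atom-below-y₂ a ⊥⋖a a→y₁ = refl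

    Z : ℕ
    Z = count (λ z → reaches n bot z ∧ belowBoth z)

    chainsToCommon-by-last : chainsToCommon n bot ≡ D n * Z
    chainsToCommon-by-last =
      ∑-uniformʳ size belowBoth (chains n bot) (D n) (λ z _ → sheffer-chains z n)

    chainsToCommon-by-first : chainsToCommon n bot ≡ k ! * count (atoms n bot y₁)
    chainsToCommon-by-first = trans
      (chainsToCommon-via-atoms k (chainsToCommon-factorial k ≤-refl) bot)
      (cong (k ! *_) (count-cong commonAtoms≡atoms))

    -- The chains from 0̂ to y₁ pass through an atom and then form a binomial interval.
    D[n+1]-by-atoms : D (1 + n) ≡ n ! * count (atoms n bot y₁)
    D[n+1]-by-atoms = trans (sym (sheffer-chains y₁ (1 + n) ⊥→y₁))
      (chains-via-atoms n bot y₁ (n !)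
        (λ a ⊥⋖a → binomial-chains a y₁ n (covers-nonbot bot a ⊥⋖a) (s≤s z≤n) (n≤1+n n)))

    c≡Z*n : c ≡ Z * n
    c≡Z*n = *-cancelʳ-≡ c (Z * n) (D n) {{≢-nonZero D[n]≢0}} (begin
      c * D n                            ≡⟨ C[n+1] ⟨
      D (1 + n)                          ≡⟨ D[n+1]-by-atoms ⟩
      n ! * count (atoms n bot y₁)       ≡⟨ *-assoc n (k !) _ ⟩
      n * (k ! * count (atoms n bot y₁)) ≡⟨ cong (n *_) chainsToCommon-by-first ⟨
      n * chainsToCommon n bot           ≡⟨ cong (n *_) chainsToCommon-by-last ⟩
      n * (D n * Z)                      ≡⟨ cong (n *_) (*-comm (D n) Z) ⟩
      n * (Z * D n)                      ≡⟨ *-assoc n Z (D n) ⟨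
      n * Z * D n                        ≡⟨ cong (_* D n) (*-comm n Z) ⟩
      Z * n * D n ∎)
      where open ≡-Reasoning

  -- Q has n + 1 ≥ 2 coatoms, so two distinct ones exist.
  n∣c : n ∣ c
  n∣c with count-witnesses (coatoms (1 + n) bot top) (subst (2 ≤_) (sym #coatoms) (s≤s (s≤s z≤n)))
  ... | y₁ , y₂ , y₁≢y₂ , y₁∈ , y₂∈ =
    let open BelowTwoCoatoms y₁ y₂ y₁≢y₂ y₁∈ y₂∈ in divides Z c≡Z*n

coatom-divisibility : (Q : FinBoundedPoset) (D B : ℕ → ℕ) (n c : ℕ) → 1 ≤ n →
  IsSheffer Q D B → HasRank Q (n + 2) → (∀ i → 1 ≤ i → i ≤ n + 1 → B i ≡ i !) →
  D (n + 1) ≡ c * D n → D (n + 2) ≡ (n + 1) * D (n + 1) → n ∣ c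
coatom-divisibility Q D B (suc k) c _ sheffer rank B≡! C[n+1] C[n+2] =
  CoatomDivisibility.n∣c Q D B sheffer k c
    (subst (λ t → 0 < chainCount Q t bot top) n+2≡ rank)
    (λ i 1≤i i≤ → B≡! i 1≤i (subst (i ≤_) (sym n+1≡) i≤))
    (subst (λ t → D t ≡ c * D (suc k)) n+1≡ C[n+1])
    (subst₂ (λ s t → D s ≡ t * D t) n+2≡ n+1≡ C[n+2])
  where
  open FinBoundedPoset Q using (bot; top)
  n+1≡ : suc k + 1 ≡ 2 + k
  n+1≡ = +-comm (suc k) 1
  n+2≡ : suc k + 2 ≡ 3 + k
  n+2≡ = +-comm (suc k) 2

-- For m ≥ 2, 2m does not divide 4m − 2: it divides 4m, so it would divide 2.
2m∤4m∸2 : ∀ m → 2 ≤ m → ¬ (2 * m ∣ 4 * m ∸ 2)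
2m∤4m∸2 m 2≤m 2m∣4m∸2 = <⇒≱ 2<2m (∣⇒≤ 2m∣2)
  where
  2m∣4m : 2 * m ∣ 4 * m
  2m∣4m = subst (2 * m ∣_) (sym (*-assoc 2 2 m)) (n∣m*n 2)
  4m∸2+2 : 4 * m ∸ 2 + 2 ≡ 4 * m
  4m∸2+2 = m∸n+n≡m (≤-trans 2≤m (m≤m+n m _))
  2m∣2 : 2 * m ∣ 2
  2m∣2 = ∣m+n∣m⇒∣n (subst (2 * m ∣_) (sym 4m∸2+2) 2m∣4m) 2m∣4m∸2
  2<2m : 2 < 2 * m
  2<2m = ≤-trans (n≤1+n 3) (*-monoʳ-≤ 2 2≤m)

lemma4p9 : (Q : FinBoundedPoset) (D B : ℕ → ℕ) (m : ℕ) → 2 ≤ m →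
    IsSheffer Q D B → Eulerian Q → HasRank Q (2 * m + 2) →
    (∀ k → 1 ≤ k → k ≤ 2 * m + 1 → B k ≡ k !) →
    ¬ ((∀ n → 2 ≤ n → n ≤ 2 * m → D n ≡ (2 * (n ∸ 1)) * D (n ∸ 1))
       × D (2 * m + 1) ≡ (4 * m ∸ 2) * D (2 * m)
       × D (2 * m + 2) ≡ (2 * m + 1) * D (2 * m + 1))
lemma4p9 Q D B m 2≤m sheffer _ rank B≡! (_ , C[2m+1] , C[2m+2]) =
  2m∤4m∸2 m 2≤m
    (coatom-divisibility Q D B (2 * m) (4 * m ∸ 2) 1≤2m sheffer rank B≡! C[2m+1] C[2m+2])
  where
  1≤2m : 1 ≤ 2 * m
  1≤2m = ≤-trans (≤-trans (s≤s z≤n) 2≤m) (m≤m+n m _)
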